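{- Let $P$ be a staircase polyomino city with $m$ faucets and $m$ customers whose upper-left boundary path consists of a sequence of north steps followed by a sequence of east steps, or whose lower-right boundary path consists of a sequence of east steps followed by a sequence of north steps. Let $\tau\in\mathfrak S_m$ be the permutation realized by the all-crossings configuration. For $i\in[m]$, let $\mu(i)$ (resp. $\nu(i)$) be the smallest (resp. largest) index of a customer reachable from faucet $i$. Then every permutation $\sigma\in\mathfrak S_m$ with $\mu(i)\le\sigma(i)\le\nu(i)$ for all $i\in[m]$ satisfies $\sigma\le\tau$ in the (strong) Bruhat order.
   Context: A staircase (parallelogram) polyomino city: a finite set $P$ of unit cells of $\mathbb Z^2$ (cell $(x,y)$ being $[x-1,x]\times[y-1,y]$) whose boundary consists of two lattice paths with unit east and north steps, both from a point $s$ to a point $t$, meeting only at $s$ and $t$: the lower-right path and the upper-left path, each with $m$ steps. (Rotated by $45^\circ$ clockwise, the hypothesis says the top path has a unique peak or the bottom path has a unique valley.) Faucets: the $m$ edges of the lower-right path numbered $1,\dots,m$ from $s$ to $t$ (each a south or east side of a cell). Customers: the $m$ edges of the upper-left path numbered $1,\dots,m$ from $s$ to $t$ (each a north or west side of a cell). A pipe configuration puts in each cell either a crossing tile (south side connected to north side, east side to west side) or an elbow tile (south side connected to west side, east side to north side); water entering at faucet $i$ follows the tiles moving north or west and exits at a customer $j$, and $i\mapsto j$ is the permutation realized by the configuration. Customer $j$ is reachable from faucet $i$ if there is a path entering $P$ through faucet edge $i$, moving from cell to adjacent cell only northward or westward inside $P$, and leaving $P$ through customer edge $j$. Bruhat order: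 $\sigma\le\tau$ iff some reduced expression of $\sigma$ is a subword of a reduced expression of $\tau$. -}

module Defs where

open import Data.Nat using (ℕ; zero; suc; pred; _≤_; _<_)
open import Data.Fin as F using (Fin; toℕ; inject₁)
open import Data.Fin.Permutation using (Permutation′; _⟨$⟩ʳ_)
import Data.Fin.Permutation.Components as PC
open import Data.Vec using (Vec; []; _∷_; lookup)
open import Data.List using (List; []; _∷_; length)
open import Data.List.Relation.Binary.Sublist.Propositional using (_⊆_)
open import Data.Product using (Σ; _×_; _,_; ∃)
open import Data.Sum using (_⊎_)
open import Data.Unit using (⊤)
open import Relation.Nullary using (¬_)
open import Relation.Binary.PropositionalEquality using (_≡_)

data Step : Set where
  E N : Step

-- Number of east (resp. north) steps among the first k steps of a path.
-- Starting at s = (0,0), the point reached after k steps is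
-- (countE k p , countN k p).
countE : {m : ℕ} → ℕ → Vec Step m → ℕ
countE zero    _       = zero
countE (suc k) []      = zero
countE (suc k) (E ∷ p) = suc (countE k p)
countE (suc k) (N ∷ p) = countE k p

countN : {m : ℕ} → ℕ → Vec Step m → ℕ
countN zero    _       = zero
countN (suc k) []      = zero
countN (suc k) (E ∷ p) = countN k p
countN (suc k) (N ∷ p) = suc (countN k p)

-- Unit lattice edges: H x y is the segment (x,y)-(x+1,y),
-- V x y is the segment (x,y)-(x,y+1).
data Edge : Set where
  H V : ℕ → ℕ → Edge

-- The edge traversed by the k-th step (k = 0,…,m-1, i.e. steps 1..m) of p.
stepEdge : {m : ℕ} → Vec Step m → Fin m → Edge
stepEdge p k with lookup p k
... | E = H (countE (toℕ k) p) (countN (toℕ k) p)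
... | N = V (countE (toℕ k) p) (countN (toℕ k) p)

-- Staircase (parallelogram) polyomino given by its lower-right path L and
-- upper-left path U, both starting at s = (0,0) with m steps: they end at
-- the same point t, and at every intermediate time 0 < k < m the point of U
-- lies strictly above (hence strictly to the left of) the point of L; in
-- particular they meet only at s and t.
IsStaircase : {m : ℕ} → Vec Step m → Vec Step m → Set
IsStaircase {m} L U =
  (countE m L ≡ countE m U) ×
  (∀ k → 0 < k → k < m → countN k L < countN k U)

-- Cell (x,y) is the unit square [x,x+1]×[y,y+1] (0-indexed coordinates,
-- with s at the origin).
InP : {m : ℕ} → Vec Step m → Vec Step m → ℕ → ℕ → Set
InP {m} L U x y =
  (Σ (Fin m) λ k → Σ ℕ λ y₀ → (stepEdge L k ≡ H x y₀) × (y₀ ≤ y)) ×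
  (Σ (Fin m) λ k → Σ ℕ λ y₁ → (stepEdge U k ≡ H x y₁) × (y < y₁))

faucet : {m : ℕ} → Vec Step m → Fin m → Edge
faucet L i = stepEdge L i

customer : {m : ℕ} → Vec Step m → Fin m → Edge
customer U j = stepEdge U j

-- Water movement.  Water on a horizontal edge moves north, on a vertical
-- edge it moves west.  H x y is the south side of cell (x,y);
-- V (x+1) y is the east side of cell (x,y).

data Enters : Edge → ℕ → ℕ → Set where
  fromSouth : ∀ {x y} → Enters (H x y) x y
  fromEast  : ∀ {x y} → Enters (V (suc x) y) x y

Leaves : {m : ℕ} → Vec Step m → Vec Step m → Edge → Set
Leaves L U e = ∀ {x y} → Enters e x y → ¬ InP L U x y

data Tile : Set where
  cross elbow : Tile

outEdge : Tile → {e : Edge} {x y : ℕ} → Enters e x y → Edge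
outEdge cross {x = x} {y} fromSouth = H x (suc y)
outEdge elbow {x = x} {y} fromSouth = V x y
outEdge cross {x = x} {y} fromEast  = V x y
outEdge elbow {x = x} {y} fromEast  = H x (suc y)

Config : Set
Config = ℕ → ℕ → Tile

allCrossings : Config
allCrossings _ _ = cross

data Flow {m : ℕ} (L U : Vec Step m) (c : Config) : Edge → Edge → Set where
  out  : ∀ {e} → Leaves L U e → Flow L U c e e
  pass : ∀ {e e' x y} (en : Enters e x y) → InP L U x y →
         Flow L U c (outEdge (c x y) en) e' → Flow L U c e e'

data Reach {m : ℕ} (L U : Vec Step m) : Edge → Edge → Set where
  out   : ∀ {e} → Leaves L U e → Reach L U e e
  north : ∀ {e e' x y} → Enters e x y → InP L U x y →
          Reach L U (H x (suc y)) e' → Reach L U e e'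
  west  : ∀ {e e' x y} → Enters e x y → InP L U x y →
          Reach L U (V x y) e' → Reach L U e e'

Reachable : {m : ℕ} → Vec Step m → Vec Step m → Fin m → Fin m → Set
Reachable L U i j = Reach L U (faucet L i) (customer U j)

Realizes : {m : ℕ} → Vec Step m → Vec Step m → Config → Permutation′ m → Set
Realizes L U c τ = ∀ i → Flow L U c (faucet L i) (customer U (τ ⟨$⟩ʳ i))

-- Simple transposition s_i (i = 0,…,m-2 standing for s_1,…,s_{m-1})
-- swapping i and i+1.
simple : {m : ℕ} → Fin (pred m) → Fin m → Fin m
simple {suc n} i = PC.transpose (inject₁ i) (F.suc i)

evalWord : {m : ℕ} → List (Fin (pred m)) → Fin m → Fin m
evalWord []      j = j
evalWord (i ∷ w) j = simple i (evalWord w j)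

IsWordOf : {m : ℕ} → List (Fin (pred m)) → Permutation′ m → Set
IsWordOf w σ = ∀ j → evalWord w j ≡ σ ⟨$⟩ʳ j

IsReducedWordOf : {m : ℕ} → List (Fin (pred m)) → Permutation′ m → Set
IsReducedWordOf w σ =
  IsWordOf w σ × (∀ w' → IsWordOf w' σ → length w ≤ length w')

_≤B_ : {m : ℕ} → Permutation′ m → Permutation′ m → Set
_≤B_ {m} σ τ = Σ (List (Fin (pred m))) λ u → Σ (List (Fin (pred m))) λ v →
  IsReducedWordOf u σ × IsReducedWordOf v τ × (u ⊆ v)

UpperNorthThenEast : {m : ℕ} → Vec Step m → Set
UpperNorthThenEast U = ∀ k l → k F.< l → lookup U k ≡ E → lookup U l ≡ E

LowerEastThenNorth : {m : ℕ} → Vec Step m → Set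
LowerEastThenNorth L = ∀ k l → k F.< l → lookup L k ≡ N → lookup L l ≡ N

{-# OPTIONS --safe #-}

-- A staircase polyomino with lower path L lies inside the Ferrers board of L, the polyomino with
-- lower path L and upper path N…N E…E, so every customer reachable from faucet k, and with it σ(k),
-- lies in the window of customers that k reaches in that board. When U = N…N E…E the polyomino is
-- this board, and the all-crossings permutation τ can be read off L.
--
-- Induct on the number of inversions of τ. If L has an east step k followed by a north step,
-- swapping them removes one cell of the board and replaces τ by τ s_k, which has one inversion
-- fewer; the windows of the smaller board contain σ if σ(k) < σ(k+1), and σ s_k otherwise.
-- Appending s_k to the words obtained for the smaller board keeps the subword relation, and the
-- words stay reduced because they are no longer than the number of inversions. If L has no such
-- corner then L = N…N E…E, so τ = id, and the windows force σ = id.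
--
-- The case L = E…E N…N is the transposed picture: reflecting in the diagonal exchanges faucets and
-- customers, turning the claim into σ⁻¹ ≤ τ⁻¹ on the Ferrers board of the reflected U, and reversing
-- reduced words brings the conclusion back.

module Submission where

open import Defs
open import Data.Bool using (true; false; if_then_else_)
open import Data.Empty using (⊥-elim)
open import Data.Fin as F using (Fin; zero; suc; toℕ; inject₁; _≟_)
open import Data.Fin.Induction using (<-wellFounded)
open import Data.Fin.Permutation
  using (Permutation′; _⟨$⟩ʳ_; _⟨$⟩ˡ_; transpose; _∘ₚ_; flip; inverseˡ; inverseʳ; lift₀-transpose)
import Data.Fin.Properties as F
open import Data.List using (List; []; _∷_; length; _∷ʳ_; reverse)
open import Data.List.Properties using (length-++; unfold-reverse; length-reverse)
open import Data.List.Relation.Binary.Sublist.Propositional using (_⊆_; []; ⊆-refl)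
open import Data.List.Relation.Binary.Sublist.Propositional.Properties using (++⁺; ++⁺ʳ; reverse⁺)
open import Data.Nat as ℕ using (ℕ; zero; suc; _+_; _≤_; _<_; z≤n; s≤s)
open import Data.Nat.Induction as ℕ using ()
open import Data.Nat.Properties as ℕ
  using (≤-refl; ≤-trans; ≤-reflexive; +-suc; +-comm; +-monoʳ-≤; n≤1+n; m≤n+m; +-commutativeSemigroup)
open import Algebra.Properties.CommutativeSemigroup +-commutativeSemigroup using (x∙yz≈y∙xz)
open import Data.Product using (Σ-syntax; ∃; _×_; _,_; proj₁; proj₂)
open import Data.Sum using (_⊎_; inj₁; inj₂)
open import Data.Vec as Vec using (Vec; []; _∷_; lookup; tabulate; count)
open import Data.Vec.Properties using (lookup∘tabulate; tabulate∘lookup; tabulate-cong; lookup-map)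
open import Function using (_∘_; id)
open import Induction.WellFounded using (Acc; acc)
open import Relation.Binary.Definitions using (tri<; tri≈; tri>)
open import Relation.Binary.PropositionalEquality
open import Relation.Nullary using (yes; no; does)
open import Relation.Nullary.Decidable using (dec-true; dec-false)

private variable
  m n : ℕ
  A : Set

-- Adjacent transpositions

simpleₚ : Fin n → Permutation′ (suc n)
simpleₚ i = transpose (inject₁ i) (suc i)

simple-suc : (i : Fin n) (j : Fin (suc n)) → simple (suc i) (suc j) ≡ suc (simple i j)
simple-suc i j = lift₀-transpose (inject₁ i) (suc i) (suc j)

simple-at-inject₁ : (i : Fin n) → simple i (inject₁ i) ≡ suc i
simple-at-inject₁ zero    = refl
simple-at-inject₁ (suc i) = trans (simple-suc i (inject₁ i)) (cong suc (simple-at-inject₁ i))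

simple-at-suc : (i : Fin n) → simple i (suc i) ≡ inject₁ i
simple-at-suc zero    = refl
simple-at-suc (suc i) = trans (simple-suc i (suc i)) (cong suc (simple-at-suc i))

simple-elsewhere : (i : Fin n) {j : Fin (suc n)} → j ≢ inject₁ i → j ≢ suc i → simple i j ≡ j
simple-elsewhere zero    {zero}        j≢i _     = ⊥-elim (j≢i refl)
simple-elsewhere zero    {suc zero}    _   j≢1+i = ⊥-elim (j≢1+i refl)
simple-elsewhere zero    {suc (suc j)} _   _     = refl
simple-elsewhere (suc i) {zero}        _   _     = refl
simple-elsewhere (suc i) {suc j}       j≢i j≢1+i =
  trans (simple-suc i j) (cong suc (simple-elsewhere i (j≢i ∘ cong suc) (j≢1+i ∘ cong suc)))

data SimpleView (i : Fin n) : Fin (suc n) → Set where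
  at-inject₁ : SimpleView i (inject₁ i)
  at-suc     : SimpleView i (suc i)
  elsewhere  : ∀ {j} → j ≢ inject₁ i → j ≢ suc i → SimpleView i j

simpleView : (i : Fin n) (j : Fin (suc n)) → SimpleView i j
simpleView i j with j ≟ inject₁ i | j ≟ suc i
... | yes refl | _        = at-inject₁
... | no _     | yes refl = at-suc
... | no j≢i   | no j≢1+i = elsewhere j≢i j≢1+i

simple-involutive : (i : Fin n) (j : Fin (suc n)) → simple i (simple i j) ≡ j
simple-involutive i j with simpleView i j
... | at-inject₁ = trans (cong (simple i) (simple-at-inject₁ i)) (simple-at-suc i)
... | at-suc     = trans (cong (simple i) (simple-at-suc i)) (simple-at-inject₁ i)
... | elsewhere j≢i j≢1+i =
  trans (cong (simple i) (simple-elsewhere i j≢i j≢1+i)) (simple-elsewhere i j≢i j≢1+i)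

-- Inversions

swapAt : Fin n → Vec A (suc n) → Vec A (suc n)
swapAt zero    (x ∷ y ∷ xs) = y ∷ x ∷ xs
swapAt (suc i) (x ∷ xs)     = x ∷ swapAt i xs

lookup-swapAt : (i : Fin n) (xs : Vec A (suc n)) (j : Fin (suc n)) →
                lookup (swapAt i xs) j ≡ lookup xs (simple i j)
lookup-swapAt zero    (x ∷ y ∷ xs) zero          = refl
lookup-swapAt zero    (x ∷ y ∷ xs) (suc zero)    = refl
lookup-swapAt zero    (x ∷ y ∷ xs) (suc (suc j)) = refl
lookup-swapAt (suc i) (x ∷ xs)     zero          = refl
lookup-swapAt (suc i) (x ∷ xs)     (suc j)       =
  trans (lookup-swapAt i xs j) (sym (cong (lookup (x ∷ xs)) (simple-suc i j)))

tabulate-∘simple : (f : Fin (suc n) → A) (i : Fin n) → tabulate (f ∘ simple i) ≡ swapAt i (tabulate f)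
tabulate-∘simple f i = begin
  tabulate (f ∘ simple i)
    ≡⟨ tabulate-cong (λ j → sym (trans (lookup-swapAt i (tabulate f) j) (lookup∘tabulate f (simple i j)))) ⟩
  tabulate (lookup (swapAt i (tabulate f)))
    ≡⟨ tabulate∘lookup _ ⟩
  swapAt i (tabulate f) ∎
  where open ≡-Reasoning

countBelow : ℕ → Vec ℕ n → ℕ
countBelow x = count (ℕ._<? x)

inversions : Vec ℕ n → ℕ
inversions []       = 0
inversions (x ∷ xs) = countBelow x xs + inversions xs

countBelow-swapAt : (x : ℕ) (i : Fin n) (xs : Vec ℕ (suc n)) → countBelow x (swapAt i xs) ≡ countBelow x xs
countBelow-swapAt x zero (y ∷ z ∷ xs) with does (y ℕ.<? x) | does (z ℕ.<? x)
... | false | false = refl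
... | false | true  = refl
... | true  | false = refl
... | true  | true  = refl
countBelow-swapAt x (suc i) (y ∷ xs) = cong (if does (y ℕ.<? x) then suc else id) (countBelow-swapAt x i xs)

countBelow-∷-< : ∀ {x y} (xs : Vec ℕ n) → y < x → countBelow x (y ∷ xs) ≡ suc (countBelow x xs)
countBelow-∷-< {x = x} {y} xs y<x rewrite dec-true (y ℕ.<? x) y<x = refl

countBelow-∷-≥ : ∀ {x y} (xs : Vec ℕ n) → x ≤ y → countBelow x (y ∷ xs) ≡ countBelow x xs
countBelow-∷-≥ {x = x} {y} xs x≤y rewrite dec-false (y ℕ.<? x) (ℕ.≤⇒≯ x≤y) = refl

countBelow-∷-≤ : (x y : ℕ) (xs : Vec ℕ n) → countBelow x (y ∷ xs) ≤ suc (countBelow x xs)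
countBelow-∷-≤ x y xs with does (y ℕ.<? x)
... | true  = ≤-refl
... | false = n≤1+n _

countBelow-∷-mono : (x y : ℕ) (xs : Vec ℕ n) → countBelow x xs ≤ countBelow x (y ∷ xs)
countBelow-∷-mono x y xs with does (y ℕ.<? x)
... | true  = n≤1+n _
... | false = ≤-refl

inversions-swapAt-≤ : (i : Fin n) (xs : Vec ℕ (suc n)) → inversions (swapAt i xs) ≤ suc (inversions xs)
inversions-swapAt-≤ zero (y ∷ z ∷ xs) = begin
  countBelow z (y ∷ xs) + (countBelow y xs + inversions xs)
    ≤⟨ ℕ.+-monoˡ-≤ _ (countBelow-∷-≤ z y xs) ⟩
  suc (countBelow z xs + (countBelow y xs + inversions xs))
    ≡⟨ cong suc (x∙yz≈y∙xz (countBelow z xs) (countBelow y xs) (inversions xs)) ⟩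
  suc (countBelow y xs + (countBelow z xs + inversions xs))
    ≤⟨ s≤s (ℕ.+-monoˡ-≤ _ (countBelow-∷-mono y z xs)) ⟩
  suc (countBelow y (z ∷ xs) + (countBelow z xs + inversions xs)) ∎
  where open ℕ.≤-Reasoning
inversions-swapAt-≤ (suc i) (y ∷ xs) = begin
  countBelow y (swapAt i xs) + inversions (swapAt i xs) ≡⟨ cong (_+ _) (countBelow-swapAt y i xs) ⟩
  countBelow y xs + inversions (swapAt i xs)            ≤⟨ +-monoʳ-≤ _ (inversions-swapAt-≤ i xs) ⟩
  countBelow y xs + suc (inversions xs)                 ≡⟨ +-suc _ _ ⟩
  suc (countBelow y xs + inversions xs)                 ∎
  where open ℕ.≤-Reasoning

inversions-swapAt-ascent : (i : Fin n) (xs : Vec ℕ (suc n)) → lookup xs (inject₁ i) < lookup xs (suc i) →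
                           inversions (swapAt i xs) ≡ suc (inversions xs)
inversions-swapAt-ascent zero (y ∷ z ∷ xs) y<z = begin
  countBelow z (y ∷ xs) + (countBelow y xs + inversions xs)
    ≡⟨ cong (_+ _) (countBelow-∷-< xs y<z) ⟩
  suc (countBelow z xs + (countBelow y xs + inversions xs))
    ≡⟨ cong suc (x∙yz≈y∙xz (countBelow z xs) (countBelow y xs) (inversions xs)) ⟩
  suc (countBelow y xs + (countBelow z xs + inversions xs))
    ≡⟨ cong (λ c → suc (c + _)) (countBelow-∷-≥ xs (ℕ.<⇒≤ y<z)) ⟨
  suc (countBelow y (z ∷ xs) + (countBelow z xs + inversions xs)) ∎
  where open ≡-Reasoning
inversions-swapAt-ascent (suc i) (y ∷ xs) asc = begin
  countBelow y (swapAt i xs) + inversions (swapAt i xs)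
    ≡⟨ cong₂ _+_ (countBelow-swapAt y i xs) (inversions-swapAt-ascent i xs asc) ⟩
  countBelow y xs + suc (inversions xs)
    ≡⟨ +-suc _ _ ⟩
  suc (countBelow y xs + inversions xs) ∎
  where open ≡-Reasoning

inversions-∘simple-≤ : (f : Fin (suc n) → ℕ) (i : Fin n) →
                       inversions (tabulate (f ∘ simple i)) ≤ suc (inversions (tabulate f))
inversions-∘simple-≤ f i = ≤-trans (≤-reflexive (cong inversions (tabulate-∘simple f i))) (inversions-swapAt-≤ i _)

inversions-∘simple-ascent : (f : Fin (suc n) → ℕ) (i : Fin n) → f (inject₁ i) < f (suc i) →
                            inversions (tabulate (f ∘ simple i)) ≡ suc (inversions (tabulate f))
inversions-∘simple-ascent f i asc = trans (cong inversions (tabulate-∘simple f i))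
  (inversions-swapAt-ascent i _ (subst₂ _<_ (sym (lookup∘tabulate f _)) (sym (lookup∘tabulate f _)) asc))

countBelow-tabulate-≤ : ∀ {x} (f : Fin n → ℕ) → (∀ j → x ≤ f j) → countBelow x (tabulate f) ≡ 0
countBelow-tabulate-≤ {zero}  f x≤f = refl
countBelow-tabulate-≤ {suc n} f x≤f =
  trans (countBelow-∷-≥ (tabulate (f ∘ suc)) (x≤f zero)) (countBelow-tabulate-≤ (f ∘ suc) (x≤f ∘ suc))

inversions-increasing : (f : Fin n → ℕ) → (∀ {i j} → i F.< j → f i < f j) → inversions (tabulate f) ≡ 0
inversions-increasing {zero}  f mono = refl
inversions-increasing {suc n} f mono = cong₂ _+_
  (countBelow-tabulate-≤ (f ∘ suc) (λ j → ℕ.<⇒≤ (mono {zero} {suc j} (s≤s z≤n))))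
  (inversions-increasing (f ∘ suc) (λ i<j → mono (s≤s i<j)))

-- Reduced words and Bruhat certificates

inversionsₚ : Permutation′ m → ℕ
inversionsₚ σ = inversions (tabulate (λ j → toℕ (σ ⟨$⟩ʳ j)))

evalWord-∷ʳ : (w : List (Fin n)) (i : Fin n) (j : Fin (suc n)) → evalWord (w ∷ʳ i) j ≡ evalWord w (simple i j)
evalWord-∷ʳ []      i j = refl
evalWord-∷ʳ (k ∷ w) i j = cong (simple k) (evalWord-∷ʳ w i j)

evalWord-reverse : (w : List (Fin n)) (j : Fin (suc n)) → evalWord (reverse w) (evalWord w j) ≡ j
evalWord-reverse []      j = refl
evalWord-reverse (i ∷ w) j = begin
  evalWord (reverse (i ∷ w)) (simple i (evalWord w j))
    ≡⟨ cong (λ v → evalWord v (simple i (evalWord w j))) (unfold-reverse i w) ⟩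
  evalWord (reverse w ∷ʳ i) (simple i (evalWord w j))
    ≡⟨ evalWord-∷ʳ (reverse w) i _ ⟩
  evalWord (reverse w) (simple i (simple i (evalWord w j)))
    ≡⟨ cong (evalWord (reverse w)) (simple-involutive i _) ⟩
  evalWord (reverse w) (evalWord w j)
    ≡⟨ evalWord-reverse w j ⟩
  j ∎
  where open ≡-Reasoning

isWordOf-reverse : ∀ w (σ : Permutation′ m) → IsWordOf w σ → IsWordOf (reverse w) (flip σ)
isWordOf-reverse {zero}  w σ word ()
isWordOf-reverse {suc n} w σ word j = begin
  evalWord (reverse w) j
    ≡⟨ cong (evalWord (reverse w)) (trans (word _) (inverseʳ σ)) ⟨
  evalWord (reverse w) (evalWord w (σ ⟨$⟩ˡ j))
    ≡⟨ evalWord-reverse w _ ⟩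
  σ ⟨$⟩ˡ j ∎
  where open ≡-Reasoning

inversions-∘evalWord : (f : Fin (suc n) → ℕ) (w : List (Fin n)) →
                       inversions (tabulate (f ∘ evalWord w)) ≤ length w + inversions (tabulate f)
inversions-∘evalWord f []      = ≤-refl
inversions-∘evalWord f (i ∷ w) = begin
  inversions (tabulate (f ∘ simple i ∘ evalWord w)) ≤⟨ inversions-∘evalWord (f ∘ simple i) w ⟩
  length w + inversions (tabulate (f ∘ simple i))   ≤⟨ +-monoʳ-≤ (length w) (inversions-∘simple-≤ f i) ⟩
  length w + suc (inversions (tabulate f))          ≡⟨ +-suc _ _ ⟩
  suc (length w + inversions (tabulate f))          ∎
  where open ℕ.≤-Reasoning

inversions≤length : ∀ w (σ : Permutation′ m) → IsWordOf w σ → inversionsₚ σ ≤ length w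
inversions≤length {zero}  w σ word = z≤n
inversions≤length {suc n} w σ word = begin
  inversionsₚ σ
    ≡⟨ cong inversions (tabulate-cong (cong toℕ ∘ word)) ⟨
  inversions (tabulate (toℕ ∘ evalWord w))
    ≤⟨ inversions-∘evalWord toℕ w ⟩
  length w + inversions (tabulate (toℕ {suc n}))
    ≡⟨ cong (length w +_) (inversions-increasing (toℕ {suc n}) (λ i<j → i<j)) ⟩
  length w + 0
    ≡⟨ ℕ.+-identityʳ _ ⟩
  length w ∎
  where open ℕ.≤-Reasoning

ShortWord : List (Fin (ℕ.pred m)) → Permutation′ m → Set
ShortWord w σ = IsWordOf w σ × length w ≤ inversionsₚ σ

shortWord⇒reduced : ∀ w (σ : Permutation′ m) → ShortWord w σ → IsReducedWordOf w σ
shortWord⇒reduced w σ (word , short) = word , λ w′ word′ → ≤-trans short (inversions≤length w′ σ word′)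

reduced-reverse : ∀ w (σ : Permutation′ m) → IsReducedWordOf w (flip σ) → IsReducedWordOf (reverse w) σ
reduced-reverse w σ (word , minimal) = isWordOf-reverse w (flip σ) word , λ w′ word′ → begin
  length (reverse w)  ≡⟨ length-reverse w ⟩
  length w            ≤⟨ minimal (reverse w′) (isWordOf-reverse w′ σ word′) ⟩
  length (reverse w′) ≡⟨ length-reverse w′ ⟩
  length w′           ∎
  where open ℕ.≤-Reasoning

BruhatCertificate : Permutation′ m → Permutation′ m → Set
BruhatCertificate {m} σ τ = Σ[ u ∈ List (Fin (ℕ.pred m)) ] Σ[ v ∈ List (Fin (ℕ.pred m)) ]
  ShortWord u σ × ShortWord v τ × u ⊆ v

certificate⇒≤B : (σ τ : Permutation′ m) → BruhatCertificate σ τ → σ ≤B τ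
certificate⇒≤B σ τ (u , v , short-u , short-v , u⊆v) =
  u , v , shortWord⇒reduced u σ short-u , shortWord⇒reduced v τ short-v , u⊆v

certificate-flip⇒≤B : (σ τ : Permutation′ m) → BruhatCertificate (flip σ) (flip τ) → σ ≤B τ
certificate-flip⇒≤B σ τ (u , v , short-u , short-v , u⊆v) =
  reverse u , reverse v ,
  reduced-reverse u σ (shortWord⇒reduced u (flip σ) short-u) ,
  reduced-reverse v τ (shortWord⇒reduced v (flip τ) short-v) ,
  reverse⁺ u⊆v

module _ (π : Permutation′ (suc n)) (i : Fin n) (descent : π ⟨$⟩ʳ suc i F.< π ⟨$⟩ʳ inject₁ i) where

  inversionsₚ-descent : inversionsₚ π ≡ suc (inversionsₚ (simpleₚ i ∘ₚ π))
  inversionsₚ-descent = begin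
    inversions (tabulate (toℕ ∘ (π ⟨$⟩ʳ_)))
      ≡⟨ cong inversions (tabulate-cong (cong (toℕ ∘ (π ⟨$⟩ʳ_)) ∘ simple-involutive i)) ⟨
    inversions (tabulate (toℕ ∘ (π ⟨$⟩ʳ_) ∘ simple i ∘ simple i))
      ≡⟨ inversions-∘simple-ascent (toℕ ∘ (π ⟨$⟩ʳ_) ∘ simple i) i ascent ⟩
    suc (inversionsₚ (simpleₚ i ∘ₚ π)) ∎
    where
    open ≡-Reasoning
    ascent : toℕ (π ⟨$⟩ʳ simple i (inject₁ i)) < toℕ (π ⟨$⟩ʳ simple i (suc i))
    ascent = subst₂ (λ a b → toℕ (π ⟨$⟩ʳ a) < toℕ (π ⟨$⟩ʳ b)) (sym (simple-at-inject₁ i)) (sym (simple-at-suc i)) descent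

  shortWord-∷ʳ : ∀ w → ShortWord w (simpleₚ i ∘ₚ π) → ShortWord (w ∷ʳ i) π
  shortWord-∷ʳ w (word , short) =
    (λ j → trans (evalWord-∷ʳ w i j) (trans (word (simple i j)) (cong (π ⟨$⟩ʳ_) (simple-involutive i j)))) ,
    (begin
      length (w ∷ʳ i)                       ≡⟨ trans (length-++ w) (+-comm _ 1) ⟩
      suc (length w)                        ≤⟨ s≤s short ⟩
      suc (inversionsₚ (simpleₚ i ∘ₚ π))    ≡⟨ inversionsₚ-descent ⟨
      inversionsₚ π                         ∎)
    where open ℕ.≤-Reasoning

certificate-∷ʳ-right : (σ τ : Permutation′ (suc n)) (i : Fin n) → τ ⟨$⟩ʳ suc i F.< τ ⟨$⟩ʳ inject₁ i →
                       BruhatCertificate σ (simpleₚ i ∘ₚ τ) → BruhatCertificate σ τ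
certificate-∷ʳ-right σ τ i descent (u , v , short-u , short-v , u⊆v) =
  u , v ∷ʳ i , short-u , shortWord-∷ʳ τ i descent v short-v , ++⁺ʳ (i ∷ []) u⊆v

certificate-∷ʳ : (σ τ : Permutation′ (suc n)) (i : Fin n) →
                 σ ⟨$⟩ʳ suc i F.< σ ⟨$⟩ʳ inject₁ i → τ ⟨$⟩ʳ suc i F.< τ ⟨$⟩ʳ inject₁ i →
                 BruhatCertificate (simpleₚ i ∘ₚ σ) (simpleₚ i ∘ₚ τ) → BruhatCertificate σ τ
certificate-∷ʳ σ τ i σ-descent τ-descent (u , v , short-u , short-v , u⊆v) =
  u ∷ʳ i , v ∷ʳ i , shortWord-∷ʳ σ i σ-descent u short-u , shortWord-∷ʳ τ i τ-descent v short-v , ++⁺ u⊆v ⊆-refl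

-- Block-bounded permutations

deflationary-injection⇒id : (g : Fin m → Fin m) → (∀ {i j} → g i ≡ g j → i ≡ j) → (∀ j → g j F.≤ j) →
                            ∀ j → g j ≡ j
deflationary-injection⇒id g injective deflationary j = fixed j (<-wellFounded j)
  where
  fixed : ∀ j → Acc F._<_ j → g j ≡ j
  fixed j (acc smaller) with g j F.<? j
  ... | yes gj<j = injective (fixed (g j) (smaller gj<j))
  ... | no  gj≮j = F.≤-antisym (deflationary j) (ℕ.≮⇒≥ gj≮j)

module _ (σ : Permutation′ m) (b : ℕ)
  (low  : ∀ j → toℕ j < b → j F.≤ σ ⟨$⟩ʳ j × toℕ (σ ⟨$⟩ʳ j) < b)
  (high : ∀ j → b ≤ toℕ j → σ ⟨$⟩ʳ j F.≤ j × b ≤ toℕ (σ ⟨$⟩ʳ j))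
  where

  private
    low⁻¹ : ∀ j → toℕ j < b → σ ⟨$⟩ˡ j F.≤ j × toℕ (σ ⟨$⟩ˡ j) < b
    low⁻¹ j j<b with toℕ (σ ⟨$⟩ˡ j) ℕ.<? b
    ... | yes i<b = subst (σ ⟨$⟩ˡ j F.≤_) (inverseʳ σ) (proj₁ (low _ i<b)) , i<b
    ... | no  i≮b = ⊥-elim (ℕ.<⇒≱ j<b (subst (λ k → b ≤ toℕ k) (inverseʳ σ) (proj₂ (high _ (ℕ.≮⇒≥ i≮b)))))

    -- σ⁻¹ on the lower block and σ on the upper block together form a deflationary injection.
    g : Fin m → Fin m
    g j with toℕ j ℕ.<? b
    ... | yes _ = σ ⟨$⟩ˡ j
    ... | no  _ = σ ⟨$⟩ʳ j

    g-deflationary : ∀ j → g j F.≤ j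
    g-deflationary j with toℕ j ℕ.<? b
    ... | yes j<b = proj₁ (low⁻¹ j j<b)
    ... | no  j≮b = proj₁ (high j (ℕ.≮⇒≥ j≮b))

    g-injective : ∀ {i j} → g i ≡ g j → i ≡ j
    g-injective {i} {j} eq with toℕ i ℕ.<? b | toℕ j ℕ.<? b
    ... | yes _   | yes _   = trans (sym (inverseʳ σ)) (trans (cong (σ ⟨$⟩ʳ_) eq) (inverseʳ σ))
    ... | no  _   | no  _   = trans (sym (inverseˡ σ)) (trans (cong (σ ⟨$⟩ˡ_) eq) (inverseˡ σ))
    ... | yes i<b | no  j≮b =
      ⊥-elim (ℕ.<⇒≱ (proj₂ (low⁻¹ i i<b)) (subst (λ k → b ≤ toℕ k) (sym eq) (proj₂ (high j (ℕ.≮⇒≥ j≮b)))))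
    ... | no  i≮b | yes j<b =
      ⊥-elim (ℕ.<⇒≱ (proj₂ (low⁻¹ j j<b)) (subst (λ k → b ≤ toℕ k) eq (proj₂ (high i (ℕ.≮⇒≥ i≮b)))))

  blockBounded⇒id : ∀ j → σ ⟨$⟩ʳ j ≡ j
  blockBounded⇒id j with toℕ j ℕ.<? b | deflationary-injection⇒id g g-injective g-deflationary j
  ... | yes _ | σ⁻¹j≡j = trans (cong (σ ⟨$⟩ʳ_) (sym σ⁻¹j≡j)) (inverseʳ σ)
  ... | no  _ | σj≡j   = σj≡j

-- Lattice paths

isE isN : Step → ℕ
isE E = 1
isE N = 0
isN E = 0
isN N = 1

countE-suc : (S : Vec Step m) (j : Fin m) → countE (suc (toℕ j)) S ≡ isE (lookup S j) + countE (toℕ j) S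
countE-suc (E ∷ S) zero    = refl
countE-suc (N ∷ S) zero    = refl
countE-suc (E ∷ S) (suc j) = trans (cong suc (countE-suc S j)) (sym (+-suc _ _))
countE-suc (N ∷ S) (suc j) = countE-suc S j

countN-suc : (S : Vec Step m) (j : Fin m) → countN (suc (toℕ j)) S ≡ isN (lookup S j) + countN (toℕ j) S
countN-suc (E ∷ S) zero    = refl
countN-suc (N ∷ S) zero    = refl
countN-suc (E ∷ S) (suc j) = countN-suc S j
countN-suc (N ∷ S) (suc j) = trans (cong suc (countN-suc S j)) (sym (+-suc _ _))

countE+countN : ∀ k (S : Vec Step m) → k ≤ m → countE k S + countN k S ≡ k
countE+countN zero    S       _         = refl
countE+countN (suc k) (E ∷ S) (s≤s k≤m) = cong suc (countE+countN k S k≤m)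
countE+countN (suc k) (N ∷ S) (s≤s k≤m) = trans (+-suc _ _) (cong suc (countE+countN k S k≤m))

countE-mono : (S : Vec Step m) {k l : ℕ} → k ≤ l → countE k S ≤ countE l S
countE-mono S       {zero}  _         = z≤n
countE-mono []      {suc k} _         = z≤n
countE-mono (E ∷ S) {suc k} (s≤s k≤l) = s≤s (countE-mono S k≤l)
countE-mono (N ∷ S) {suc k} (s≤s k≤l) = countE-mono S k≤l

countN-mono : (S : Vec Step m) {k l : ℕ} → k ≤ l → countN k S ≤ countN l S
countN-mono S       {zero}  _         = z≤n
countN-mono []      {suc k} _         = z≤n
countN-mono (E ∷ S) {suc k} (s≤s k≤l) = countN-mono S k≤l
countN-mono (N ∷ S) {suc k} (s≤s k≤l) = s≤s (countN-mono S k≤l)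

countE-swapAt : ∀ l (i : Fin n) (S : Vec Step (suc n)) → l ≢ suc (toℕ i) → countE l (swapAt i S) ≡ countE l S
countE-swapAt zero          i       S           _ = refl
countE-swapAt (suc zero)    zero    S           l≢ = ⊥-elim (l≢ refl)
countE-swapAt (suc (suc l)) zero    (E ∷ E ∷ S) _ = refl
countE-swapAt (suc (suc l)) zero    (E ∷ N ∷ S) _ = refl
countE-swapAt (suc (suc l)) zero    (N ∷ E ∷ S) _ = refl
countE-swapAt (suc (suc l)) zero    (N ∷ N ∷ S) _ = refl
countE-swapAt (suc l)       (suc i) (E ∷ S)     l≢ = cong suc (countE-swapAt l i S (l≢ ∘ cong suc))
countE-swapAt (suc l)       (suc i) (N ∷ S)     l≢ = countE-swapAt l i S (l≢ ∘ cong suc)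

countN-swapAt : ∀ l (i : Fin n) (S : Vec Step (suc n)) → l ≢ suc (toℕ i) → countN l (swapAt i S) ≡ countN l S
countN-swapAt zero          i       S           _ = refl
countN-swapAt (suc zero)    zero    S           l≢ = ⊥-elim (l≢ refl)
countN-swapAt (suc (suc l)) zero    (E ∷ E ∷ S) _ = refl
countN-swapAt (suc (suc l)) zero    (E ∷ N ∷ S) _ = refl
countN-swapAt (suc (suc l)) zero    (N ∷ E ∷ S) _ = refl
countN-swapAt (suc (suc l)) zero    (N ∷ N ∷ S) _ = refl
countN-swapAt (suc l)       (suc i) (E ∷ S)     l≢ = countN-swapAt l i S (l≢ ∘ cong suc)
countN-swapAt (suc l)       (suc i) (N ∷ S)     l≢ = cong suc (countN-swapAt l i S (l≢ ∘ cong suc))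

reflect : Step → Step
reflect E = N
reflect N = E

reflectPath : Vec Step m → Vec Step m
reflectPath = Vec.map reflect

countE-reflect : ∀ k (S : Vec Step m) → countE k (reflectPath S) ≡ countN k S
countE-reflect zero    S       = refl
countE-reflect (suc k) []      = refl
countE-reflect (suc k) (E ∷ S) = countE-reflect k S
countE-reflect (suc k) (N ∷ S) = cong suc (countE-reflect k S)

countN-reflect : ∀ k (S : Vec Step m) → countN k (reflectPath S) ≡ countE k S
countN-reflect zero    S       = refl
countN-reflect (suc k) []      = refl
countN-reflect (suc k) (E ∷ S) = cong suc (countN-reflect k S)
countN-reflect (suc k) (N ∷ S) = countN-reflect k S

northEast-tail : ∀ {s} {S : Vec Step m} → UpperNorthThenEast (s ∷ S) → UpperNorthThenEast S
northEast-tail h k l k<l = h (suc k) (suc l) (s≤s k<l)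

northEast-∷ : ∀ {s t} {R : Vec Step m} → UpperNorthThenEast (t ∷ R) → (s ≡ E → t ≡ E) →
              UpperNorthThenEast (s ∷ t ∷ R)
northEast-∷ h s⇒t zero    (suc zero)    _         s≡E = s⇒t s≡E
northEast-∷ h s⇒t zero    (suc (suc l)) _         s≡E = h zero (suc l) (s≤s z≤n) (s⇒t s≡E)
northEast-∷ h s⇒t (suc k) (suc l)       (s≤s k<l) q   = h k l k<l q

northEast-north : (S : Vec Step m) → UpperNorthThenEast S → ∀ j → lookup S j ≡ N → countE (toℕ j) S ≡ 0
northEast-north (s ∷ S) h zero    _ = refl
northEast-north (E ∷ S) h (suc j) q with trans (sym (h zero (suc j) (s≤s z≤n) refl)) q
... | ()
northEast-north (N ∷ S) h (suc j) q = northEast-north S (northEast-tail h) j q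

countN-allEast : ∀ k (S : Vec Step m) → (∀ j → lookup S j ≡ E) → countN k S ≡ 0
countN-allEast zero    S       _     = refl
countN-allEast (suc k) []      _     = refl
countN-allEast (suc k) (E ∷ S) east  = countN-allEast k S (east ∘ suc)
countN-allEast (suc k) (N ∷ S) east  with east zero
... | ()

northEast-east : (S : Vec Step m) → UpperNorthThenEast S → ∀ j → lookup S j ≡ E → countN (toℕ j) S ≡ countN m S
northEast-east {suc n} (E ∷ S) h zero _ = sym (countN-allEast n S (λ l → h zero (suc l) (s≤s z≤n) refl))
northEast-east (E ∷ S) h (suc j) q = northEast-east S (northEast-tail h) j q
northEast-east (N ∷ S) h (suc j) q = cong suc (northEast-east S (northEast-tail h) j q)

EastNorthAt : Vec Step (suc n) → Fin n → Set
EastNorthAt S k = lookup S (inject₁ k) ≡ E × lookup S (suc k) ≡ N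

eastNorth-or-northEast : (S : Vec Step (suc n)) → (∃ λ k → EastNorthAt S k) ⊎ UpperNorthThenEast S
eastNorth-or-northEast (s ∷ [])    = inj₂ λ { zero zero () ; zero (suc ()) ; (suc ()) }
eastNorth-or-northEast (s ∷ t ∷ R) with eastNorth-or-northEast (t ∷ R)
... | inj₁ (k , en) = inj₁ (suc k , en)
... | inj₂ h with s | t
...   | E | N = inj₁ (zero , refl , refl)
...   | E | E = inj₂ (northEast-∷ h λ _ → refl)
...   | N | _ = inj₂ (northEast-∷ h λ ())

eastNorth⇒reflect-northEast : (S : Vec Step m) → LowerEastThenNorth S → UpperNorthThenEast (reflectPath S)
eastNorth⇒reflect-northEast S eastNorth k l k<l Sk≡E = begin
  lookup (reflectPath S) l
    ≡⟨ lookup-map l reflect S ⟩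
  reflect (lookup S l)
    ≡⟨ cong reflect (eastNorth k l k<l (reflect-≡E (trans (sym (lookup-map k reflect S)) Sk≡E))) ⟩
  E ∎
  where
  open ≡-Reasoning
  reflect-≡E : ∀ {s} → reflect s ≡ E → s ≡ N
  reflect-≡E {N} _ = refl

-- Ferrers boards

-- In the Ferrers board of a path with b north steps, customer y < b is the west side of row y and
-- customer b + x the top side of column x; all crossings send an east step of the lower path to
-- the customer of its column and a north step to the customer of its row.
ferrersLabel : Step → (b x y : ℕ) → ℕ
ferrersLabel E b x y = b + x
ferrersLabel N b x y = y

ferrersLabel-cong : ∀ {s s′ b b′ x x′ y y′} → s ≡ s′ → b ≡ b′ → x ≡ x′ → y ≡ y′ →
                    ferrersLabel s b x y ≡ ferrersLabel s′ b′ x′ y′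
ferrersLabel-cong refl refl refl refl = refl

ferrersPerm : Vec Step m → Fin m → ℕ
ferrersPerm {m} S j = ferrersLabel (lookup S j) (countN m S) (countE (toℕ j) S) (countN (toℕ j) S)

IsFerrersPerm : Vec Step m → Permutation′ m → Set
IsFerrersPerm S τ = ∀ j → toℕ (τ ⟨$⟩ʳ j) ≡ ferrersPerm S j

-- The customers that faucet k reaches in the Ferrers board of S.
record InFerrersWindow (S : Vec Step m) (k c : ℕ) : Set where
  constructor between
  field
    lower : countN k S ≤ c
    upper : c < countN m S + countE (suc k) S

open InFerrersWindow public

FerrersWindow : Vec Step m → Permutation′ m → Set
FerrersWindow S σ = ∀ j → InFerrersWindow S (toℕ j) (toℕ (σ ⟨$⟩ʳ j))

ferrersPerm-E : (S : Vec Step m) (j : Fin m) → lookup S j ≡ E → ferrersPerm S j ≡ countN m S + countE (toℕ j) S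
ferrersPerm-E {m} S j Sj≡E = cong (λ s → ferrersLabel s (countN m S) (countE (toℕ j) S) (countN (toℕ j) S)) Sj≡E

ferrersPerm-N : (S : Vec Step m) (j : Fin m) → lookup S j ≡ N → ferrersPerm S j ≡ countN (toℕ j) S
ferrersPerm-N {m} S j Sj≡N = cong (λ s → ferrersLabel s (countN m S) (countE (toℕ j) S) (countN (toℕ j) S)) Sj≡N

window-cong : ∀ {S T : Vec Step m} {k l c} → countN k S ≡ countN l T →
              countN m S + countE (suc k) S ≡ countN m T + countE (suc l) T →
              InFerrersWindow S k c → InFerrersWindow T l c
window-cong {c = c} N≡ bound≡ (between low high) = between (subst (_≤ c) N≡ low) (subst (c <_) bound≡ high)

window-between-values : ∀ {S : Vec Step m} {k c₁ c c₂} → c₁ ≤ c → c ≤ c₂ →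
                        InFerrersWindow S k c₁ → InFerrersWindow S k c₂ → InFerrersWindow S k c
window-between-values c₁≤c c≤c₂ w₁ w₂ = between (≤-trans (lower w₁) c₁≤c) (ℕ.≤-<-trans c≤c₂ (upper w₂))

window-between-indices : ∀ {S : Vec Step m} {i k l c} → i ≤ k → k ≤ l →
                         InFerrersWindow S i c → InFerrersWindow S l c → InFerrersWindow S k c
window-between-indices {S = S} i≤k k≤l wᵢ wₗ =
  between (≤-trans (countN-mono S k≤l) (lower wₗ))
          (ℕ.<-≤-trans (upper wᵢ) (ℕ.+-monoʳ-≤ _ (countE-mono S (s≤s i≤k))))

ferrersPerm-reflect-north : (S : Vec Step m) (j : Fin m) → lookup S j ≡ N →
                            ferrersPerm (reflectPath S) j ≡ countE m S + countN (toℕ j) S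
ferrersPerm-reflect-north {m} S j Sj≡N = begin
  ferrersPerm (reflectPath S) j
    ≡⟨ ferrersPerm-E (reflectPath S) j (trans (lookup-map j reflect S) (cong reflect Sj≡N)) ⟩
  countN m (reflectPath S) + countE (toℕ j) (reflectPath S)
    ≡⟨ cong₂ _+_ (countN-reflect m S) (countE-reflect (toℕ j) S) ⟩
  countE m S + countN (toℕ j) S ∎
  where open ≡-Reasoning

ferrersPerm-reflect-east : (S : Vec Step m) (j : Fin m) → lookup S j ≡ E →
                           ferrersPerm (reflectPath S) j ≡ countE (toℕ j) S
ferrersPerm-reflect-east S j Sj≡E =
  trans (ferrersPerm-N (reflectPath S) j (trans (lookup-map j reflect S) (cong reflect Sj≡E))) (countN-reflect (toℕ j) S)

module _ (S : Vec Step m) (northEast : UpperNorthThenEast S) where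

  private
    b = countN m S

    index-split : ∀ j → countE (toℕ j) S + countN (toℕ j) S ≡ toℕ j
    index-split j = countE+countN (toℕ j) S (ℕ.<⇒≤ (F.toℕ<n j))

    north-index : ∀ j → lookup S j ≡ N → countN (toℕ j) S ≡ toℕ j
    north-index j Sj≡N = trans (sym (cong (_+ countN (toℕ j) S) (northEast-north S northEast j Sj≡N))) (index-split j)

    north-index-< : ∀ j → lookup S j ≡ N → toℕ j < b
    north-index-< j Sj≡N = begin
      suc (toℕ j)              ≡⟨ cong suc (north-index j Sj≡N) ⟨
      suc (countN (toℕ j) S)   ≡⟨ cong (_+ countN (toℕ j) S) (cong isN Sj≡N) ⟨
      isN (lookup S j) + countN (toℕ j) S ≡⟨ countN-suc S j ⟨
      countN (suc (toℕ j)) S   ≤⟨ countN-mono S (F.toℕ<n j) ⟩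
      b                        ∎
      where open ℕ.≤-Reasoning

    east-index : ∀ j → lookup S j ≡ E → b + countE (toℕ j) S ≡ toℕ j
    east-index j Sj≡E = trans (cong (_+ countE (toℕ j) S) (sym (northEast-east S northEast j Sj≡E)))
                                (trans (+-comm (countN (toℕ j) S) _) (index-split j))

  northEast-ferrersPerm : ∀ j → ferrersPerm S j ≡ toℕ j
  northEast-ferrersPerm j with lookup S j in Sj
  ... | E = east-index j Sj
  ... | N = north-index j Sj

  northEast-window⇒id : (σ : Permutation′ m) → FerrersWindow S σ → ∀ j → σ ⟨$⟩ʳ j ≡ j
  northEast-window⇒id σ window = blockBounded⇒id σ b low high
    where
    low : ∀ j → toℕ j < b → j F.≤ σ ⟨$⟩ʳ j × toℕ (σ ⟨$⟩ʳ j) < b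
    low j j<b with lookup S j in Sj
    ... | E = ⊥-elim (ℕ.<⇒≱ j<b (subst (b ≤_) (east-index j Sj) (ℕ.m≤m+n b _)))
    ... | N = subst (_≤ toℕ (σ ⟨$⟩ʳ j)) (north-index j Sj) (lower (window j)) ,
              subst (toℕ (σ ⟨$⟩ʳ j) <_) (trans (cong (b +_) no-east-step) (ℕ.+-identityʳ b)) (upper (window j))
      where
      no-east-step : countE (suc (toℕ j)) S ≡ 0
      no-east-step = trans (countE-suc S j) (cong₂ _+_ (cong isE Sj) (northEast-north S northEast j Sj))
    high : ∀ j → b ≤ toℕ j → σ ⟨$⟩ʳ j F.≤ j × b ≤ toℕ (σ ⟨$⟩ʳ j)
    high j b≤j with lookup S j in Sj
    ... | N = ⊥-elim (ℕ.<⇒≱ (north-index-< j Sj) b≤j)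
    ... | E = ℕ.≤-pred (subst (toℕ (σ ⟨$⟩ʳ j) <_) one-more-east (upper (window j))) ,
              subst (_≤ toℕ (σ ⟨$⟩ʳ j)) (northEast-east S northEast j Sj) (lower (window j))
      where
      one-more-east : b + countE (suc (toℕ j)) S ≡ suc (toℕ j)
      one-more-east = begin
        b + countE (suc (toℕ j)) S
          ≡⟨ cong (b +_) (trans (countE-suc S j) (cong (_+ countE (toℕ j) S) (cong isE Sj))) ⟩
        b + suc (countE (toℕ j) S)
          ≡⟨ +-suc b _ ⟩
        suc (b + countE (toℕ j) S)
          ≡⟨ cong suc (east-index j Sj) ⟩
        suc (toℕ j) ∎
        where open ≡-Reasoning

  northEast-certificate : (σ τ : Permutation′ m) → IsFerrersPerm S τ → FerrersWindow S σ → BruhatCertificate σ τ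
  northEast-certificate σ τ τ-ferrers window =
    [] , [] , identity σ (northEast-window⇒id σ window) ,
    identity τ (λ j → F.toℕ-injective (trans (τ-ferrers j) (northEast-ferrersPerm j))) , []
    where
    identity : (π : Permutation′ m) → (∀ j → π ⟨$⟩ʳ j ≡ j) → ShortWord [] π
    identity π fixed = (λ j → sym (fixed j)) , z≤n

module _ (S : Vec Step (suc n)) (k : Fin n)
         (Sk≡E : lookup S (inject₁ k) ≡ E) (Sk+1≡N : lookup S (suc k) ≡ N) where

  private
    S′ = swapAt k S
    K  = toℕ k
    K′ = toℕ (inject₁ k)
    b  = countN (suc n) S
    x  = countE K′ S

    K′≡K : K′ ≡ K
    K′≡K = F.toℕ-inject₁ k

    N-at-k+1 : countN (suc K) S ≡ countN K′ S
    N-at-k+1 = trans (cong (λ l → countN (suc l) S) (sym K′≡K))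
      (trans (countN-suc S (inject₁ k)) (cong (λ s → isN s + countN K′ S) Sk≡E))

    E-at-k+1 : countE (suc K) S ≡ suc x
    E-at-k+1 = trans (cong (λ l → countE (suc l) S) (sym K′≡K))
      (trans (countE-suc S (inject₁ k)) (cong (λ s → isE s + x) Sk≡E))

    E-at-k+2 : countE (suc (suc K)) S ≡ countE (suc K) S
    E-at-k+2 = trans (countE-suc S (suc k)) (cong (λ s → isE s + countE (suc K) S) Sk+1≡N)

    N-at-k+2 : countN (suc (suc K)) S ≡ suc (countN (suc K) S)
    N-at-k+2 = trans (countN-suc S (suc k)) (cong (λ s → isN s + countN (suc K) S) Sk+1≡N)

    K′≢1+K : K′ ≢ suc K
    K′≢1+K eq = ℕ.1+n≢n (sym (trans (sym K′≡K) eq))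

    S′-at-k : lookup S′ (inject₁ k) ≡ N
    S′-at-k = trans (lookup-swapAt k S (inject₁ k)) (trans (cong (lookup S) (simple-at-inject₁ k)) Sk+1≡N)

    S′-at-k+1 : lookup S′ (suc k) ≡ E
    S′-at-k+1 = trans (lookup-swapAt k S (suc k)) (trans (cong (lookup S) (simple-at-suc k)) Sk≡E)

    total′ : countN (suc n) S′ ≡ b
    total′ = countN-swapAt (suc n) k S (λ eq → ℕ.<-irrefl (sym (ℕ.suc-injective eq)) (F.toℕ<n k))

    N′-at-k : countN K′ S′ ≡ countN K′ S
    N′-at-k = countN-swapAt K′ k S K′≢1+K

    N′-at-k+1 : countN (suc K) S′ ≡ suc (countN K′ S)
    N′-at-k+1 = trans (cong (λ l → countN (suc l) S′) (sym K′≡K))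
      (trans (countN-suc S′ (inject₁ k)) (cong₂ _+_ (cong isN S′-at-k) N′-at-k))

    E′-at-k+1 : countE (suc K) S′ ≡ x
    E′-at-k+1 = trans (cong (λ l → countE (suc l) S′) (sym K′≡K))
      (trans (countE-suc S′ (inject₁ k)) (cong₂ _+_ (cong isE S′-at-k) (countE-swapAt K′ k S K′≢1+K)))

    E′-at-k+2 : countE (suc (suc K)) S′ ≡ countE (suc (suc K)) S
    E′-at-k+2 = countE-swapAt (suc (suc K)) k S (ℕ.1+n≢n ∘ ℕ.suc-injective)

    module Elsewhere {j : Fin (suc n)} (j≢k : j ≢ inject₁ k) (j≢k+1 : j ≢ suc k) where
      index≢ : toℕ j ≢ suc K
      index≢ = j≢k+1 ∘ F.toℕ-injective
      suc-index≢ : suc (toℕ j) ≢ suc K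
      suc-index≢ eq = j≢k (F.toℕ-injective (trans (ℕ.suc-injective eq) (sym K′≡K)))
      step′ : lookup S′ j ≡ lookup S j
      step′ = trans (lookup-swapAt k S j) (cong (lookup S) (simple-elsewhere k j≢k j≢k+1))
      N′ : countN (toℕ j) S′ ≡ countN (toℕ j) S
      N′ = countN-swapAt (toℕ j) k S index≢
      E′ : countE (toℕ j) S′ ≡ countE (toℕ j) S
      E′ = countE-swapAt (toℕ j) k S index≢
      sucE′ : countE (suc (toℕ j)) S′ ≡ countE (suc (toℕ j)) S
      sucE′ = countE-swapAt (suc (toℕ j)) k S suc-index≢

  ferrersPerm-swapAt : ∀ j → ferrersPerm S (simple k j) ≡ ferrersPerm (swapAt k S) j
  ferrersPerm-swapAt j with simpleView k j
  ... | at-inject₁ = begin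
    ferrersPerm S (simple k (inject₁ k)) ≡⟨ cong (ferrersPerm S) (simple-at-inject₁ k) ⟩
    ferrersPerm S (suc k)                ≡⟨ ferrersPerm-N S (suc k) Sk+1≡N ⟩
    countN (suc K) S                     ≡⟨ trans N-at-k+1 (sym N′-at-k) ⟩
    countN K′ S′                         ≡⟨ ferrersPerm-N S′ (inject₁ k) S′-at-k ⟨
    ferrersPerm S′ (inject₁ k)           ∎
    where open ≡-Reasoning
  ... | at-suc = begin
    ferrersPerm S (simple k (suc k))     ≡⟨ cong (ferrersPerm S) (simple-at-suc k) ⟩
    ferrersPerm S (inject₁ k)            ≡⟨ ferrersPerm-E S (inject₁ k) Sk≡E ⟩
    b + x                                ≡⟨ cong₂ _+_ total′ E′-at-k+1 ⟨
    countN (suc n) S′ + countE (suc K) S′ ≡⟨ ferrersPerm-E S′ (suc k) S′-at-k+1 ⟨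
    ferrersPerm S′ (suc k)               ∎
    where open ≡-Reasoning
  ... | elsewhere j≢k j≢k+1 = trans (cong (ferrersPerm S) (simple-elsewhere k j≢k j≢k+1))
    (sym (ferrersLabel-cong step′ total′ E′ N′))
    where open Elsewhere j≢k j≢k+1

  ferrersPerm-descent : ferrersPerm S (suc k) < ferrersPerm S (inject₁ k)
  ferrersPerm-descent = begin-strict
    ferrersPerm S (suc k)      ≡⟨ ferrersPerm-N S (suc k) Sk+1≡N ⟩
    countN (suc K) S           <⟨ ℕ.n<1+n _ ⟩
    suc (countN (suc K) S)     ≡⟨ N-at-k+2 ⟨
    countN (suc (suc K)) S     ≤⟨ countN-mono S (F.toℕ<n (suc k)) ⟩
    b                          ≤⟨ ℕ.m≤m+n b x ⟩
    b + x                      ≡⟨ ferrersPerm-E S (inject₁ k) Sk≡E ⟨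
    ferrersPerm S (inject₁ k)  ∎
    where open ℕ.≤-Reasoning

  window-k⇒k+1 : ∀ {c} → InFerrersWindow S K′ c → InFerrersWindow S (suc K) c
  window-k⇒k+1 = window-cong (sym N-at-k+1) (cong (b +_) (trans (cong (λ l → countE (suc l) S) K′≡K) (sym E-at-k+2)))

  window-k+1⇒k : ∀ {c} → InFerrersWindow S (suc K) c → InFerrersWindow S K′ c
  window-k+1⇒k = window-cong N-at-k+1 (cong (b +_) (trans E-at-k+2 (cong (λ l → countE (suc l) S) (sym K′≡K))))

  window-∘simple : (σ : Permutation′ (suc n)) → FerrersWindow S σ → FerrersWindow S (simpleₚ k ∘ₚ σ)
  window-∘simple σ window j with simpleView k j
  ... | at-inject₁ = subst (λ i → InFerrersWindow S K′ (toℕ (σ ⟨$⟩ʳ i))) (sym (simple-at-inject₁ k))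
                           (window-k+1⇒k (window (suc k)))
  ... | at-suc     = subst (λ i → InFerrersWindow S (suc K) (toℕ (σ ⟨$⟩ʳ i))) (sym (simple-at-suc k))
                           (window-k⇒k+1 (window (inject₁ k)))
  ... | elsewhere j≢k j≢k+1 =
    subst (λ i → InFerrersWindow S (toℕ j) (toℕ (σ ⟨$⟩ʳ i))) (sym (simple-elsewhere k j≢k j≢k+1)) (window j)

  window-swapAt : (σ : Permutation′ (suc n)) → FerrersWindow S σ → σ ⟨$⟩ʳ inject₁ k F.< σ ⟨$⟩ʳ suc k →
                  FerrersWindow (swapAt k S) σ
  window-swapAt σ window P<Q j with simpleView k j
  ... | at-inject₁ = between (subst (_≤ P) (sym N′-at-k) (lower (window (inject₁ k)))) (begin-strict
      P
        <⟨ P<Q ⟩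
      Q
        ≤⟨ ℕ.≤-pred (subst (Q <_) (trans (cong (b +_) (trans E-at-k+2 E-at-k+1)) (+-suc b x))
                           (upper (window (suc k)))) ⟩
      b + x
        ≡⟨ cong₂ _+_ total′ (trans (cong (λ l → countE (suc l) S′) K′≡K) E′-at-k+1) ⟨
      countN (suc n) S′ + countE (suc K′) S′ ∎)
    where
    open ℕ.≤-Reasoning
    P = toℕ (σ ⟨$⟩ʳ inject₁ k)
    Q = toℕ (σ ⟨$⟩ʳ suc k)
  ... | at-suc = between (subst (_≤ Q) (sym N′-at-k+1) (ℕ.≤-<-trans (lower (window (inject₁ k))) P<Q))
                         (subst (Q <_) (sym (cong₂ _+_ total′ E′-at-k+2)) (upper (window (suc k))))
    where
    P = toℕ (σ ⟨$⟩ʳ inject₁ k)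
    Q = toℕ (σ ⟨$⟩ʳ suc k)
  ... | elsewhere j≢k j≢k+1 = window-cong (sym N′) (sym (cong₂ _+_ total′ sucE′)) (window j)
    where open Elsewhere j≢k j≢k+1

  ferrers-swapAt : (τ : Permutation′ (suc n)) → IsFerrersPerm S τ → IsFerrersPerm (swapAt k S) (simpleₚ k ∘ₚ τ)
  ferrers-swapAt τ τ-ferrers j = trans (τ-ferrers (simple k j)) (ferrersPerm-swapAt j)

  ferrers-descent : (τ : Permutation′ (suc n)) → IsFerrersPerm S τ → τ ⟨$⟩ʳ suc k F.< τ ⟨$⟩ʳ inject₁ k
  ferrers-descent τ τ-ferrers = subst₂ _<_ (sym (τ-ferrers (suc k))) (sym (τ-ferrers (inject₁ k))) ferrersPerm-descent

  certificate-from-swapAt : (σ τ : Permutation′ (suc n)) → IsFerrersPerm S τ → FerrersWindow S σ →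
                            (∀ σ′ → FerrersWindow (swapAt k S) σ′ → BruhatCertificate σ′ (simpleₚ k ∘ₚ τ)) →
                            BruhatCertificate σ τ
  certificate-from-swapAt σ τ τ-ferrers window certify with F.<-cmp (σ ⟨$⟩ʳ inject₁ k) (σ ⟨$⟩ʳ suc k)
  ... | tri< ascent _ _ =
    certificate-∷ʳ-right σ τ k (ferrers-descent τ τ-ferrers) (certify σ (window-swapAt σ window ascent))
  ... | tri≈ _ same _ =
    ⊥-elim (F.<⇒≢ (F.≤̄⇒inject₁< F.≤-refl) (trans (sym (inverseˡ σ)) (trans (cong (σ ⟨$⟩ˡ_) same) (inverseˡ σ))))
  ... | tri> _ _ descent =
    certificate-∷ʳ σ τ k descent (ferrers-descent τ τ-ferrers)
      (certify (simpleₚ k ∘ₚ σ) (window-swapAt (simpleₚ k ∘ₚ σ) (window-∘simple σ window) ascent))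
    where
    ascent : σ ⟨$⟩ʳ simple k (inject₁ k) F.< σ ⟨$⟩ʳ simple k (suc k)
    ascent = subst₂ (λ i i′ → σ ⟨$⟩ʳ i F.< σ ⟨$⟩ʳ i′) (sym (simple-at-inject₁ k)) (sym (simple-at-suc k)) descent

ferrers-certificate : (S : Vec Step m) (σ τ : Permutation′ m) → IsFerrersPerm S τ → FerrersWindow S σ →
                      BruhatCertificate σ τ
ferrers-certificate S σ τ τ-ferrers window = certify S σ τ τ-ferrers window (ℕ.<-wellFounded (inversionsₚ τ))
  where
  certify : ∀ {m} (S : Vec Step m) (σ τ : Permutation′ m) → IsFerrersPerm S τ → FerrersWindow S σ →
            Acc _<_ (inversionsₚ τ) → BruhatCertificate σ τ
  certify {zero}  S σ τ τ-ferrers window _ = northEast-certificate S (λ ()) σ τ τ-ferrers window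
  certify {suc n} S σ τ τ-ferrers window (acc smaller) with eastNorth-or-northEast S
  ... | inj₂ northEast = northEast-certificate S northEast σ τ τ-ferrers window
  ... | inj₁ (k , Sk≡E , Sk+1≡N) =
    certificate-from-swapAt S k Sk≡E Sk+1≡N σ τ τ-ferrers window λ σ′ window′ →
      certify (swapAt k S) σ′ (simpleₚ k ∘ₚ τ) (ferrers-swapAt S k Sk≡E Sk+1≡N τ τ-ferrers) window′
        (smaller (≤-reflexive (sym (inversionsₚ-descent τ k (ferrers-descent S k Sk≡E Sk+1≡N τ τ-ferrers)))))

-- Pipes

start end : Edge → ℕ × ℕ
start (H x y) = x , y
start (V x y) = x , y
end   (H x y) = suc x , y
end   (V x y) = x , suc y

_↖_ : ℕ × ℕ → ℕ × ℕ → Set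
(x , y) ↖ (x′ , y′) = x′ ≤ x × y ≤ y′

↖-trans : ∀ {p q r} → p ↖ q → q ↖ r → p ↖ r
↖-trans {_ , _} {_ , _} {_ , _} (x₂≤x₁ , y₁≤y₂) (x₃≤x₂ , y₂≤y₃) = ≤-trans x₃≤x₂ x₂≤x₁ , ≤-trans y₁≤y₂ y₂≤y₃

record _⇖_ (e e′ : Edge) : Set where
  constructor _,_
  field
    starts : start e ↖ start e′
    ends   : end e ↖ end e′

⇖-refl : ∀ e → e ⇖ e
⇖-refl (H x y) = (≤-refl , ≤-refl) , (≤-refl , ≤-refl)
⇖-refl (V x y) = (≤-refl , ≤-refl) , (≤-refl , ≤-refl)

⇖-trans : ∀ {e e′ e″} → e ⇖ e′ → e′ ⇖ e″ → e ⇖ e″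
⇖-trans (s , t) (s′ , t′) = ↖-trans s s′ , ↖-trans t t′

enters-⇖-north : ∀ {e x y} → Enters e x y → e ⇖ H x (suc y)
enters-⇖-north fromSouth = (≤-refl , n≤1+n _) , (≤-refl , n≤1+n _)
enters-⇖-north fromEast  = (n≤1+n _ , n≤1+n _) , (≤-refl , ≤-refl)

enters-⇖-west : ∀ {e x y} → Enters e x y → e ⇖ V x y
enters-⇖-west fromSouth = (≤-refl , ≤-refl) , (n≤1+n _ , n≤1+n _)
enters-⇖-west fromEast  = (n≤1+n _ , ≤-refl) , (n≤1+n _ , ≤-refl)

reach-⇖ : ∀ {L U : Vec Step m} {e e′} → Reach L U e e′ → e ⇖ e′
reach-⇖ (out {e} _)    = ⇖-refl e
reach-⇖ (north en _ r) = ⇖-trans (enters-⇖-north en) (reach-⇖ r)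
reach-⇖ (west en _ r)  = ⇖-trans (enters-⇖-west en) (reach-⇖ r)

point : ℕ → Vec Step m → ℕ × ℕ
point k S = countE k S , countN k S

stepEdge-start : (S : Vec Step m) (k : Fin m) → start (stepEdge S k) ≡ point (toℕ k) S
stepEdge-start S k with lookup S k
... | E = refl
... | N = refl

stepEdge-end : (S : Vec Step m) (k : Fin m) → end (stepEdge S k) ≡ point (suc (toℕ k)) S
stepEdge-end S k = trans end-by-step (sym (cong₂ _,_ (countE-suc S k) (countN-suc S k)))
  where
  end-by-step : end (stepEdge S k) ≡ (isE (lookup S k) + countE (toℕ k) S , isN (lookup S k) + countN (toℕ k) S)
  end-by-step with lookup S k
  ... | E = refl
  ... | N = refl

open _⇖_

reachable-↖ : ∀ {L U : Vec Step m} {k j} → Reachable L U k j →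
              point (toℕ k) L ↖ point (toℕ j) U × point (suc (toℕ k)) L ↖ point (suc (toℕ j)) U
reachable-↖ {L = L} {U} {k} {j} r =
  subst₂ _↖_ (stepEdge-start L k) (stepEdge-start U j) (starts (reach-⇖ r)) ,
  subst₂ _↖_ (stepEdge-end L k) (stepEdge-end U j) (ends (reach-⇖ r))

module _ {L U : Vec Step m} (staircase : IsStaircase L U) where

  north-total : countN m U ≡ countN m L
  north-total = ℕ.+-cancelˡ-≡ (countE m L) _ _ (begin
    countE m L + countN m U ≡⟨ cong (_+ countN m U) (proj₁ staircase) ⟩
    countE m U + countN m U ≡⟨ countE+countN m U ≤-refl ⟩
    m                       ≡⟨ countE+countN m L ≤-refl ⟨
    countE m L + countN m L ∎)
    where open ≡-Reasoning

  reachable-window : ∀ {k j} → Reachable L U k j → InFerrersWindow L (toℕ k) (toℕ j)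
  reachable-window {k} {j} r = between
    (begin
      countN (toℕ k) L                   ≤⟨ proj₂ (proj₁ (reachable-↖ r)) ⟩
      countN (toℕ j) U                   ≤⟨ m≤n+m _ _ ⟩
      countE (toℕ j) U + countN (toℕ j) U ≡⟨ countE+countN (toℕ j) U (ℕ.<⇒≤ (F.toℕ<n j)) ⟩
      toℕ j                              ∎)
    (begin
      suc (toℕ j)
        ≡⟨ countE+countN (suc (toℕ j)) U (F.toℕ<n j) ⟨
      countE (suc (toℕ j)) U + countN (suc (toℕ j)) U
        ≤⟨ ℕ.+-mono-≤ (proj₁ (proj₂ (reachable-↖ r))) (countN-mono U (F.toℕ<n j)) ⟩
      countE (suc (toℕ k)) L + countN m U
        ≡⟨ trans (cong (countE (suc (toℕ k)) L +_) north-total) (+-comm (countE (suc (toℕ k)) L) _) ⟩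
      countN m L + countE (suc (toℕ k)) L ∎)
    where open ℕ.≤-Reasoning

  reachable-window-reflected : ∀ {k j} → Reachable L U k j → InFerrersWindow (reflectPath U) (toℕ j) (toℕ k)
  reachable-window-reflected {k} {j} r = between
    (begin
      countN (toℕ j) (reflectPath U)     ≡⟨ countN-reflect (toℕ j) U ⟩
      countE (toℕ j) U                   ≤⟨ proj₁ (proj₁ (reachable-↖ r)) ⟩
      countE (toℕ k) L                   ≤⟨ ℕ.m≤m+n _ _ ⟩
      countE (toℕ k) L + countN (toℕ k) L ≡⟨ countE+countN (toℕ k) L (ℕ.<⇒≤ (F.toℕ<n k)) ⟩
      toℕ k                              ∎)
    (begin
      suc (toℕ k)
        ≡⟨ countE+countN (suc (toℕ k)) L (F.toℕ<n k) ⟨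
      countE (suc (toℕ k)) L + countN (suc (toℕ k)) L
        ≤⟨ ℕ.+-mono-≤ (countE-mono L (F.toℕ<n k)) (proj₂ (proj₂ (reachable-↖ r))) ⟩
      countE m L + countN (suc (toℕ j)) U
        ≡⟨ cong₂ _+_ (trans (proj₁ staircase) (sym (countN-reflect m U))) (sym (countE-reflect (suc (toℕ j)) U)) ⟩
      countN m (reflectPath U) + countE (suc (toℕ j)) (reflectPath U) ∎)
    where open ℕ.≤-Reasoning

flow-keeps-column : ∀ {L U : Vec Step m} {x y e′} → Flow L U allCrossings (H x y) e′ → ∃ λ y′ → e′ ≡ H x y′
flow-keeps-column (out _)              = _ , refl
flow-keeps-column (pass fromSouth _ f) = flow-keeps-column f

flow-keeps-row : ∀ {L U : Vec Step m} {x y e′} → Flow L U allCrossings (V x y) e′ → ∃ λ x′ → e′ ≡ V x′ y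
flow-keeps-row (out _)             = _ , refl
flow-keeps-row (pass fromEast _ f) = flow-keeps-row f

stepEdge-E : (S : Vec Step m) (k : Fin m) → lookup S k ≡ E → stepEdge S k ≡ H (countE (toℕ k) S) (countN (toℕ k) S)
stepEdge-E S k Sk≡E with lookup S k
stepEdge-E S k refl | E = refl

stepEdge-N : (S : Vec Step m) (k : Fin m) → lookup S k ≡ N → stepEdge S k ≡ V (countE (toℕ k) S) (countN (toℕ k) S)
stepEdge-N S k Sk≡N with lookup S k
stepEdge-N S k refl | N = refl

module _ {L U : Vec Step m} {τ : Permutation′ m} (realizes : Realizes L U allCrossings τ) (k : Fin m) where

  allCrossings-column : lookup L k ≡ E → lookup U (τ ⟨$⟩ʳ k) ≡ E × countE (toℕ (τ ⟨$⟩ʳ k)) U ≡ countE (toℕ k) L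
  allCrossings-column Lk≡E
    with flow-keeps-column (subst (λ e → Flow L U allCrossings e _) (stepEdge-E L k Lk≡E) (realizes k))
       | lookup U (τ ⟨$⟩ʳ k) in Uτk
  ... | _ , same-column | E = refl , cong column (trans (sym (stepEdge-E U _ Uτk)) same-column)
    where
    column : Edge → ℕ
    column (H x _) = x
    column (V x _) = x
  ... | _ , same-column | N with trans (sym (stepEdge-N U _ Uτk)) same-column
  ...   | ()

  allCrossings-row : lookup L k ≡ N → lookup U (τ ⟨$⟩ʳ k) ≡ N × countN (toℕ (τ ⟨$⟩ʳ k)) U ≡ countN (toℕ k) L
  allCrossings-row Lk≡N
    with flow-keeps-row (subst (λ e → Flow L U allCrossings e _) (stepEdge-N L k Lk≡N) (realizes k))
       | lookup U (τ ⟨$⟩ʳ k) in Uτk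
  ... | _ , same-row | N = refl , cong row (trans (sym (stepEdge-N U _ Uτk)) same-row)
    where
    row : Edge → ℕ
    row (H _ y) = y
    row (V _ y) = y
  ... | _ , same-row | E with trans (sym (stepEdge-E U _ Uτk)) same-row
  ...   | ()

  ferrersPerm-allCrossings : IsStaircase L U → ferrersPerm U (τ ⟨$⟩ʳ k) ≡ ferrersPerm L k
  ferrersPerm-allCrossings staircase with lookup L k in Lk
  ... | E = trans (ferrersPerm-E U _ (proj₁ (allCrossings-column Lk)))
                  (cong₂ _+_ (north-total staircase) (proj₂ (allCrossings-column Lk)))
  ... | N = trans (ferrersPerm-N U _ (proj₁ (allCrossings-row Lk))) (proj₂ (allCrossings-row Lk))

  ferrersPerm-reflect-allCrossings : IsStaircase L U →
                                     ferrersPerm (reflectPath U) (τ ⟨$⟩ʳ k) ≡ ferrersPerm (reflectPath L) k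
  ferrersPerm-reflect-allCrossings staircase with lookup L k in Lk
  ... | E = begin
    ferrersPerm (reflectPath U) (τ ⟨$⟩ʳ k) ≡⟨ ferrersPerm-reflect-east U _ (proj₁ (allCrossings-column Lk)) ⟩
    countE (toℕ (τ ⟨$⟩ʳ k)) U              ≡⟨ proj₂ (allCrossings-column Lk) ⟩
    countE (toℕ k) L                       ≡⟨ ferrersPerm-reflect-east L k Lk ⟨
    ferrersPerm (reflectPath L) k          ∎
    where open ≡-Reasoning
  ... | N = begin
    ferrersPerm (reflectPath U) (τ ⟨$⟩ʳ k)
      ≡⟨ ferrersPerm-reflect-north U _ (proj₁ (allCrossings-row Lk)) ⟩
    countE m U + countN (toℕ (τ ⟨$⟩ʳ k)) U
      ≡⟨ cong₂ _+_ (sym (proj₁ staircase)) (proj₂ (allCrossings-row Lk)) ⟩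
    countE m L + countN (toℕ k) L
      ≡⟨ ferrersPerm-reflect-north L k Lk ⟨
    ferrersPerm (reflectPath L) k ∎
    where open ≡-Reasoning

mainTheorem2 : {m : ℕ} (L U : Vec Step m) → IsStaircase L U →
    (UpperNorthThenEast U ⊎ LowerEastThenNorth L) →
    (τ : Permutation′ m) → Realizes L U allCrossings τ →
    (μ ν : Fin m → Fin m) →
    (∀ i → Reachable L U i (μ i) × (∀ j → Reachable L U i j → μ i F.≤ j)) →
    (∀ i → Reachable L U i (ν i) × (∀ j → Reachable L U i j → j F.≤ ν i)) →
    (σ : Permutation′ m) → (∀ i → (μ i F.≤ σ ⟨$⟩ʳ i) × (σ ⟨$⟩ʳ i F.≤ ν i)) →
    σ ≤B τ
mainTheorem2 L U staircase (inj₁ northEast) τ realizes μ ν hμ hν σ hσ =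
  certificate⇒≤B σ τ (ferrers-certificate L σ τ τ-ferrers window)
  where
  τ-ferrers : IsFerrersPerm L τ
  τ-ferrers k = trans (sym (northEast-ferrersPerm U northEast (τ ⟨$⟩ʳ k)))
                      (ferrersPerm-allCrossings {L = L} {U} {τ} realizes k staircase)
  window : FerrersWindow L σ
  window k = window-between-values (proj₁ (hσ k)) (proj₂ (hσ k))
    (reachable-window staircase (proj₁ (hμ k))) (reachable-window staircase (proj₁ (hν k)))
mainTheorem2 L U staircase (inj₂ eastNorth) τ realizes μ ν hμ hν σ hσ =
  certificate-flip⇒≤B σ τ (ferrers-certificate (reflectPath U) (flip σ) (flip τ) τ⁻¹-ferrers window)
  where
  τ⁻¹-ferrers : IsFerrersPerm (reflectPath U) (flip τ)
  τ⁻¹-ferrers j = begin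
    toℕ (τ ⟨$⟩ˡ j)
      ≡⟨ northEast-ferrersPerm (reflectPath L) (eastNorth⇒reflect-northEast L eastNorth) _ ⟨
    ferrersPerm (reflectPath L) (τ ⟨$⟩ˡ j)
      ≡⟨ ferrersPerm-reflect-allCrossings {L = L} {U} {τ} realizes _ staircase ⟨
    ferrersPerm (reflectPath U) (τ ⟨$⟩ʳ (τ ⟨$⟩ˡ j))
      ≡⟨ cong (ferrersPerm (reflectPath U)) (inverseʳ τ) ⟩
    ferrersPerm (reflectPath U) j ∎
    where open ≡-Reasoning
  window : FerrersWindow (reflectPath U) (flip σ)
  window j = window-between-indices
    (subst (μ k F.≤_) (inverseʳ σ) (proj₁ (hσ k))) (subst (F._≤ ν k) (inverseʳ σ) (proj₂ (hσ k)))
    (reachable-window-reflected staircase (proj₁ (hμ k))) (reachable-window-reflected staircase (proj₁ (hν k)))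
    where k = σ ⟨$⟩ˡ j
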